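{- Let $\Gamma$ be a finite set of PDL$^\Box$-formulas and $M^\mathsf{c}(\Gamma)$ its canonical model. For all $W\in S(\Gamma)$, if $\Box\gamma\in\mathsf{FL}^{\pm}(\Gamma)$ and $\Box\gamma\not\vdash\bot$, then $\Box\gamma\in W$ iff for all $W'\in S(\Gamma)$, if $\langle W,W'\rangle\in R^\mathsf{c}_\Box$ then $\gamma\in W'$.
   Context: PDL$^\Box$-formulas over countably infinite $\mathsf{At}_\mathsf{f}$, $\mathsf{At}_\mathsf{p}$: $\gamma ::= a\mid\bot\mid\neg\gamma\mid\gamma\lor\gamma\mid\langle\pi\rangle\gamma\mid\Box\gamma$, $\pi::=\mathsf{p}\mid\pi;\pi\mid\pi\cup\pi\mid\pi^*\mid ?\gamma$; $[\pi]\gamma:=\neg\langle\pi\rangle\neg\gamma$, $\Diamond\gamma:=\neg\Box\neg\gamma$. $\vdash$ is derivability in PDL$^\Box$: axioms propositional tautologies; $[\pi](\gamma_1\to\gamma_2)\to([\pi]\gamma_1\to[\pi]\gamma_2)$; $[\pi](\gamma_1\land\gamma_2)\leftrightarrow([\pi]\gamma_1\land[\pi]\gamma_2)$; $[\pi_1\cup\pi_2]\gamma\leftrightarrow([\pi_1]\gamma\land[\pi_2]\gamma)$; $[?\alpha]\beta\leftrightarrow(\alpha\to\beta)$; $[\pi_1;\pi_2]\gamma\leftrightarrow[\pi_1][\pi_2]\gamma$; $(\gamma\land[\pi][\pi^*]\gamma)\leftrightarrow[\pi^*]\gamma$; $(\gamma\land[\pi^*](\gamma\to[\pi]\gamma))\to[\pi^*]\gamma$;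 $\Box(\gamma_1\to\gamma_2)\to(\Box\gamma_1\to\Box\gamma_2)$; $\Box\gamma\to\gamma$; $\Diamond\gamma\to\Box\Diamond\gamma$; $\langle\pi\rangle\gamma\to\Diamond\gamma$; rules modus ponens, $\gamma\Rightarrow[\pi]\gamma$, $\gamma\Rightarrow\Box\gamma$; $\varphi\not\vdash\bot$ means $\not\vdash\neg\varphi$. Fischer–Ladner closure $\mathsf{FL}(\Gamma)$: smallest set containing $\Gamma$, closed under subformulas, with $\langle ?\gamma_1\rangle\gamma_2\in\mathsf{FL}\Rightarrow\gamma_1\in\mathsf{FL}$; $\langle\pi_1;\pi_2\rangle\gamma\in\mathsf{FL}\Rightarrow\langle\pi_1\rangle\langle\pi_2\rangle\gamma\in\mathsf{FL}$; $\langle\pi_1\cup\pi_2\rangle\gamma\in\mathsf{FL}\Rightarrow\langle\pi_1\rangle\gamma,\langle\pi_2\rangle\gamma\in\mathsf{FL}$; $\langle\pi^*\rangle\gamma\in\mathsf{FL}\Rightarrow\langle\pi\rangle\gamma,\langle\pi\rangle\langle\pi^*\rangle\gamma\in\mathsf{FL}$. $\mathsf{FL}^\pm(\Gamma)=\mathsf{FL}(\Gamma)\cup\{\neg\gamma:\gamma\in\mathsf{FL}(\Gamma)\}$; $S(\Gamma)$ is the set of maximal consistent subsets of $\mathsf{FL}^\pm(\Gamma)$; each $W\in S(\Gamma)$ is identified with the formula $\bigwedge W$. $R^\mathsf{c}_\Box$ is the relation on $S(\Gamma)$ with $\langle W_1,W_2\rangle\in R^\mathsf{c}_\Box$ iff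 $W_1\land\Diamond W_2\not\vdash\bot$. -}

module Defs where

open import Data.Nat using (ℕ)
open import Data.Bool using (Bool; true; false; not; _∨_)
open import Data.List using (List; []; _∷_; foldr)
open import Data.List.Membership.Propositional using (_∈_)
open import Data.Product using (Σ; _×_; _,_)
open import Data.Sum using (_⊎_)
open import Relation.Binary.PropositionalEquality using (_≡_)
open import Relation.Nullary using (¬_)

AtF : Set
AtF = ℕ

AtP : Set
AtP = ℕ

mutual
  data Fm : Set where
    atom : AtF → Fm
    ⊥̇    : Fm
    ¬̇_   : Fm → Fm
    _∨̇_  : Fm → Fm → Fm
    ⟨_⟩_ : Prog → Fm → Fm
    □_   : Fm → Fm

  data Prog : Set where
    patom : AtP → Prog
    _⨾_   : Prog → Prog → Prog
    _∪̇_   : Prog → Prog → Prog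
    _*    : Prog → Prog
    ¿_    : Fm → Prog

infixr 30 ¬̇_ □_ ◇_ ⟨_⟩_ [_]_
infixl 25 _∧̇_
infixl 24 _∨̇_
infixr 22 _⇒_
infix  21 _⇔̇_

[_]_ : Prog → Fm → Fm
[ π ] γ = ¬̇ ⟨ π ⟩ ¬̇ γ

◇_ : Fm → Fm
◇ γ = ¬̇ □ ¬̇ γ

_⇒_ : Fm → Fm → Fm
a ⇒ b = ¬̇ a ∨̇ b

_∧̇_ : Fm → Fm → Fm
a ∧̇ b = ¬̇ (¬̇ a ∨̇ ¬̇ b)

_⇔̇_ : Fm → Fm → Fm
a ⇔̇ b = (a ⇒ b) ∧̇ (b ⇒ a)

⊤̇ : Fm
⊤̇ = ¬̇ ⊥̇

-- Propositional tautologies: formulas true under every Boolean valuation that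
-- treats atoms, ⟨π⟩γ and □γ as propositional variables.
evalP : (Fm → Bool) → Fm → Bool
evalP v (atom a)  = v (atom a)
evalP v ⊥̇         = false
evalP v (¬̇ a)     = not (evalP v a)
evalP v (a ∨̇ b)   = evalP v a ∨ evalP v b
evalP v (⟨ π ⟩ a) = v (⟨ π ⟩ a)
evalP v (□ a)     = v (□ a)

Tautology : Fm → Set
Tautology φ = ∀ (v : Fm → Bool) → evalP v φ ≡ true

data ⊢_ : Fm → Set where
  taut    : ∀ {φ} → Tautology φ → ⊢ φ
  K-prog  : ∀ {π a b} → ⊢ ([ π ] (a ⇒ b) ⇒ ([ π ] a ⇒ [ π ] b))
  conj    : ∀ {π a b} → ⊢ ([ π ] (a ∧̇ b) ⇔̇ ([ π ] a ∧̇ [ π ] b))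
  choice  : ∀ {π₁ π₂ a} → ⊢ ([ π₁ ∪̇ π₂ ] a ⇔̇ ([ π₁ ] a ∧̇ [ π₂ ] a))
  test    : ∀ {a b} → ⊢ ([ ¿ a ] b ⇔̇ (a ⇒ b))
  comp    : ∀ {π₁ π₂ a} → ⊢ ([ π₁ ⨾ π₂ ] a ⇔̇ [ π₁ ] [ π₂ ] a)
  mix     : ∀ {π a} → ⊢ ((a ∧̇ [ π ] [ π * ] a) ⇔̇ [ π * ] a)
  ind     : ∀ {π a} → ⊢ ((a ∧̇ [ π * ] (a ⇒ [ π ] a)) ⇒ [ π * ] a)
  K-box   : ∀ {a b} → ⊢ (□ (a ⇒ b) ⇒ (□ a ⇒ □ b))
  T-box   : ∀ {a} → ⊢ (□ a ⇒ a)
  5-box   : ∀ {a} → ⊢ (◇ a ⇒ □ ◇ a)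
  dia-box : ∀ {π a} → ⊢ (⟨ π ⟩ a ⇒ ◇ a)
  mp      : ∀ {a b} → ⊢ a → ⊢ (a ⇒ b) → ⊢ b
  nec-prog : ∀ {π a} → ⊢ a → ⊢ [ π ] a
  nec-box  : ∀ {a} → ⊢ a → ⊢ □ a

-- φ ⊬ ⊥  means  ⊬ ¬φ
Consistent : Fm → Set
Consistent φ = ¬ (⊢ ¬̇ φ)

data FL (Γ : List Fm) : Fm → Set where
  base    : ∀ {φ} → φ ∈ Γ → FL Γ φ
  sub-neg : ∀ {a} → FL Γ (¬̇ a) → FL Γ a
  sub-orL : ∀ {a b} → FL Γ (a ∨̇ b) → FL Γ a
  sub-orR : ∀ {a b} → FL Γ (a ∨̇ b) → FL Γ b
  sub-dia : ∀ {π a} → FL Γ (⟨ π ⟩ a) → FL Γ a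
  sub-box : ∀ {a} → FL Γ (□ a) → FL Γ a
  fl-test : ∀ {a b} → FL Γ (⟨ ¿ a ⟩ b) → FL Γ a
  fl-seq  : ∀ {π₁ π₂ a} → FL Γ (⟨ π₁ ⨾ π₂ ⟩ a) → FL Γ (⟨ π₁ ⟩ ⟨ π₂ ⟩ a)
  fl-chL  : ∀ {π₁ π₂ a} → FL Γ (⟨ π₁ ∪̇ π₂ ⟩ a) → FL Γ (⟨ π₁ ⟩ a)
  fl-chR  : ∀ {π₁ π₂ a} → FL Γ (⟨ π₁ ∪̇ π₂ ⟩ a) → FL Γ (⟨ π₂ ⟩ a)
  fl-star₁ : ∀ {π a} → FL Γ (⟨ π * ⟩ a) → FL Γ (⟨ π ⟩ a)
  fl-star₂ : ∀ {π a} → FL Γ (⟨ π * ⟩ a) → FL Γ (⟨ π ⟩ ⟨ π * ⟩ a)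

FL± : List Fm → Fm → Set
FL± Γ φ = FL Γ φ ⊎ Σ Fm (λ ψ → FL Γ ψ × φ ≡ ¬̇ ψ)

⋀ : List Fm → Fm
⋀ = foldr _∧̇_ ⊤̇

-- W ∈ S(Γ): W is a maximal consistent subset of FL±(Γ)
-- (FL(Γ) is finite, so such subsets are finite and are represented by lists).
MCS : List Fm → List Fm → Set
MCS Γ W =
  (∀ {φ} → φ ∈ W → FL± Γ φ) ×
  Consistent (⋀ W) ×
  (∀ φ → FL± Γ φ → Consistent (⋀ (φ ∷ W)) → φ ∈ W)

Rc□ : List Fm → List Fm → Set
Rc□ W₁ W₂ = Consistent (⋀ W₁ ∧̇ ◇ (⋀ W₂))

-- If □γ ∈ W then W ⊢ □γ, so for W ∧ ◇W′ to be consistent W′ must be consistent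
-- with γ, and maximality puts γ into W′. Conversely, if □γ ∉ W then W ∧ ◇¬γ is
-- consistent, and {¬γ} can be extended one Fischer–Ladner formula at a time to a
-- maximal W′ with W ∧ ◇W′ still consistent: were W ∧ ◇(φ ∧ X) and W ∧ ◇(¬φ ∧ X)
-- both inconsistent, K would make W ∧ ◇X inconsistent. Then γ ∉ W′. FL(Γ) is finite
-- because it is covered by an explicit list closed under the Fischer–Ladner rules.
-- The choices made in the extension are classical; this is harmless since what is
-- proved with them is a negation.
module Submission where

open import Defs
open import Data.Bool using (Bool; true; false; not; _∨_; _∧_; T)
open import Data.Bool.Properties using (T-∧; T-≡)
open import Data.Fin using (Fin; zero; suc)
open import Data.List using (List; []; _∷_; _++_)
open import Data.List.Membership.Propositional using (_∈_)
open import Data.List.Membership.Propositional.Properties using (∈-++⁺ˡ; ∈-++⁺ʳ; ∈-++⁻)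
open import Data.List.Relation.Binary.Subset.Propositional using (_⊆_)
open import Data.List.Relation.Binary.Subset.Propositional.Properties using (⊆-refl; xs⊆ys++xs)
open import Data.List.Relation.Unary.Any using (here; there)
open import Data.Nat using (ℕ; zero; suc)
open import Data.Product using (_,_; proj₁; proj₂)
open import Data.Sum using (_⊎_; inj₁; inj₂)
open import Data.Vec using (Vec; []; _∷_; lookup; map)
open import Data.Vec.Properties using (lookup-map)
open import Function using (_∘_; _⇔_; mk⇔; Equivalence)
open import Level using (0ℓ)
open import Relation.Binary.PropositionalEquality using (_≡_; refl; sym; cong; cong₂)
open import Relation.Nullary using (¬_; yes; no; contradiction)
open import Relation.Nullary.Negation using (DoubleNegation; ¬¬-Monad)
open import Relation.Nullary.Decidable using (¬¬-excluded-middle)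
open import Effect.Monad using (RawMonad)

open RawMonad (¬¬-Monad {0ℓ}) using (_>>=_; _<$>_; pure)

private
  variable
    n : ℕ
    a b c d γ : Fm
    A Δ Γ : List Fm

data Schema (n : ℕ) : Set where
  var  : Fin n → Schema n
  ⊥ˢ   : Schema n
  ¬ˢ_  : Schema n → Schema n
  _∨ˢ_ : Schema n → Schema n → Schema n

infixr 30 ¬ˢ_
infixl 25 _∧ˢ_
infixl 24 _∨ˢ_
infixr 22 _⇒ˢ_

_∧ˢ_ _⇒ˢ_ : Schema n → Schema n → Schema n
s ∧ˢ t = ¬ˢ (¬ˢ s ∨ˢ ¬ˢ t)
s ⇒ˢ t = ¬ˢ s ∨ˢ t

⊤ˢ : Schema n
⊤ˢ = ¬ˢ ⊥ˢ

P : Schema (suc n)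
P = var zero

Q : Schema (suc (suc n))
Q = var (suc zero)

R : Schema (suc (suc (suc n)))
R = var (suc (suc zero))

S : Schema (suc (suc (suc (suc n))))
S = var (suc (suc (suc zero)))

instantiate : Schema n → Vec Fm n → Fm
instantiate (var i)  σ = lookup σ i
instantiate ⊥ˢ       σ = ⊥̇
instantiate (¬ˢ s)   σ = ¬̇ instantiate s σ
instantiate (s ∨ˢ t) σ = instantiate s σ ∨̇ instantiate t σ

evalˢ : Vec Bool n → Schema n → Bool
evalˢ ρ (var i)  = lookup ρ i
evalˢ ρ ⊥ˢ       = false
evalˢ ρ (¬ˢ s)   = not (evalˢ ρ s)
evalˢ ρ (s ∨ˢ t) = evalˢ ρ s ∨ evalˢ ρ t

evalP-instantiate : ∀ v (σ : Vec Fm n) s → evalP v (instantiate s σ) ≡ evalˢ (map (evalP v) σ) s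
evalP-instantiate v σ (var i)  = sym (lookup-map i (evalP v) σ)
evalP-instantiate v σ ⊥ˢ       = refl
evalP-instantiate v σ (¬ˢ s)   = cong not (evalP-instantiate v σ s)
evalP-instantiate v σ (s ∨ˢ t) = cong₂ _∨_ (evalP-instantiate v σ s) (evalP-instantiate v σ t)

allTrue : ∀ n → (Vec Bool n → Bool) → Bool
allTrue zero    f = f []
allTrue (suc n) f = allTrue n (f ∘ (true ∷_)) ∧ allTrue n (f ∘ (false ∷_))

allTrue-sound : ∀ n f → T (allTrue n f) → ∀ ρ → T (f ρ)
allTrue-sound zero    f ok []          = ok
allTrue-sound (suc n) f ok (true ∷ ρ)  = allTrue-sound n _ (proj₁ (Equivalence.to T-∧ ok)) ρ
allTrue-sound (suc n) f ok (false ∷ ρ) = allTrue-sound n _ (proj₂ (Equivalence.to T-∧ ok)) ρ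

ValidSchema : Schema n → Set
ValidSchema {n} s = T (allTrue n (λ ρ → evalˢ ρ s))

-- The validity side condition evaluates a truth table, so for a concrete schema it
-- reduces to ⊤ and is filled in automatically.
tautology : (s : Schema n) (σ : Vec Fm n) {_ : ValidSchema s} → ⊢ instantiate s σ
tautology {n} s σ {valid} = taut λ v → Equivalence.to T-≡ (holds v)
  where
  holds : ∀ v → T (evalP v (instantiate s σ))
  holds v rewrite evalP-instantiate v σ s = allTrue-sound n _ valid (map (evalP v) σ)

∧-elimˡ : ⊢ a ∧̇ b ⇒ a
∧-elimˡ {a} {b} = tautology (P ∧ˢ Q ⇒ˢ P) (a ∷ b ∷ [])

∧-elimʳ : ⊢ a ∧̇ b ⇒ b
∧-elimʳ {a} {b} = tautology (P ∧ˢ Q ⇒ˢ Q) (a ∷ b ∷ [])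

⇒-weaken : ⊢ b → ⊢ a ⇒ b
⇒-weaken {b} {a} ⊢b = mp ⊢b (tautology (Q ⇒ˢ P ⇒ˢ Q) (a ∷ b ∷ []))

⇒-trans : ⊢ a ⇒ b → ⊢ b ⇒ c → ⊢ a ⇒ c
⇒-trans {a} {b} {c} p q =
  mp q (mp p (tautology ((P ⇒ˢ Q) ⇒ˢ (Q ⇒ˢ R) ⇒ˢ P ⇒ˢ R) (a ∷ b ∷ c ∷ [])))

⇒-combine : ⊢ a ⇒ b → ⊢ a ⇒ c → ⊢ b ⇒ c ⇒ d → ⊢ a ⇒ d
⇒-combine {a} {b} {c} {d} p q r = mp r (mp q (mp p (tautology
  ((P ⇒ˢ Q) ⇒ˢ (P ⇒ˢ R) ⇒ˢ (Q ⇒ˢ R ⇒ˢ S) ⇒ˢ P ⇒ˢ S)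
  (a ∷ b ∷ c ∷ d ∷ []))))

refute : ⊢ a ⇒ b → ⊢ a ⇒ ¬̇ b → ⊢ ¬̇ a
refute {a} {b} p q =
  mp q (mp p (tautology ((P ⇒ˢ Q) ⇒ˢ (P ⇒ˢ ¬ˢ Q) ⇒ˢ ¬ˢ P) (a ∷ b ∷ [])))

curry¬ : ⊢ ¬̇ (a ∧̇ b) → ⊢ a ⇒ ¬̇ b
curry¬ {a} {b} p = mp p (tautology (¬ˢ (P ∧ˢ Q) ⇒ˢ P ⇒ˢ ¬ˢ Q) (a ∷ b ∷ []))

curry¬ʳ : ⊢ ¬̇ (a ∧̇ b) → ⊢ b ⇒ ¬̇ a
curry¬ʳ {a} {b} p = mp p (tautology (¬ˢ (P ∧ˢ Q) ⇒ˢ Q ⇒ˢ ¬ˢ P) (a ∷ b ∷ []))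

uncurry¬ʳ : ⊢ b ⇒ ¬̇ a → ⊢ ¬̇ (a ∧̇ b)
uncurry¬ʳ {b} {a} p = mp p (tautology ((Q ⇒ˢ ¬ˢ P) ⇒ˢ ¬ˢ (P ∧ˢ Q)) (a ∷ b ∷ []))

uncurry¬¬ʳ : ⊢ b ⇒ a → ⊢ ¬̇ (¬̇ a ∧̇ b)
uncurry¬¬ʳ {b} {a} p = mp p (tautology ((Q ⇒ˢ P) ⇒ˢ ¬ˢ (¬ˢ P ∧ˢ Q)) (a ∷ b ∷ []))

¬◇⇒□¬ : ⊢ ¬̇ (a ∧̇ ◇ b) → ⊢ a ⇒ □ ¬̇ b
¬◇⇒□¬ {a} {b} p = mp p (tautology (¬ˢ (P ∧ˢ ¬ˢ Q) ⇒ˢ P ⇒ˢ Q) (a ∷ □ ¬̇ b ∷ []))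

□¬⇒¬◇ : ⊢ a ⇒ □ ¬̇ b → ⊢ ¬̇ (a ∧̇ ◇ b)
□¬⇒¬◇ {a} {b} p = mp p (tautology ((P ⇒ˢ Q) ⇒ˢ ¬ˢ (P ∧ˢ ¬ˢ Q)) (a ∷ □ ¬̇ b ∷ []))

□-mono : ⊢ a ⇒ b → ⊢ □ a ⇒ □ b
□-mono p = mp (nec-box p) K-box

□-mono₂ : ⊢ a ⇒ b ⇒ c → ⊢ □ a ⇒ □ b ⇒ □ c
□-mono₂ p = ⇒-trans (□-mono p) K-box

◇-split : ⊢ ¬̇ (a ∧̇ ◇ (b ∧̇ c)) → ⊢ ¬̇ (a ∧̇ ◇ (¬̇ b ∧̇ c)) → ⊢ ¬̇ (a ∧̇ ◇ c)
◇-split {a} {b} {c} p q = □¬⇒¬◇ (⇒-combine (¬◇⇒□¬ p) (¬◇⇒□¬ q) (□-mono₂ case-split))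
  where
  case-split : ⊢ ¬̇ (b ∧̇ c) ⇒ ¬̇ (¬̇ b ∧̇ c) ⇒ ¬̇ c
  case-split = tautology (¬ˢ (P ∧ˢ Q) ⇒ˢ ¬ˢ (¬ˢ P ∧ˢ Q) ⇒ˢ ¬ˢ Q) (b ∷ c ∷ [])

⋀-elim : a ∈ A → ⊢ ⋀ A ⇒ a
⋀-elim (here refl) = ∧-elimˡ
⋀-elim (there a∈A) = ⇒-trans ∧-elimʳ (⋀-elim a∈A)

data Step : Fm → Fm → Set where
  s-neg  : Step (¬̇ a) a
  s-orL  : Step (a ∨̇ b) a
  s-orR  : Step (a ∨̇ b) b
  s-dia  : ∀ {π} → Step (⟨ π ⟩ a) a
  s-box  : Step (□ a) a
  s-test : Step (⟨ ¿ a ⟩ b) a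
  s-seq  : ∀ {π₁ π₂} → Step (⟨ π₁ ⨾ π₂ ⟩ a) (⟨ π₁ ⟩ ⟨ π₂ ⟩ a)
  s-chL  : ∀ {π₁ π₂} → Step (⟨ π₁ ∪̇ π₂ ⟩ a) (⟨ π₁ ⟩ a)
  s-chR  : ∀ {π₁ π₂} → Step (⟨ π₁ ∪̇ π₂ ⟩ a) (⟨ π₂ ⟩ a)
  s-st₁  : ∀ {π} → Step (⟨ π * ⟩ a) (⟨ π ⟩ a)
  s-st₂  : ∀ {π} → Step (⟨ π * ⟩ a) (⟨ π ⟩ ⟨ π * ⟩ a)

StepsInto : List Fm → List Fm → Set
StepsInto xs ys = ∀ {a b} → a ∈ xs → Step a b → b ∈ ys

Closed : List Fm → Set
Closed xs = StepsInto xs xs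

mutual
  fl : Fm → List Fm
  fl a = a ∷ fl⁻ a

  fl⁻ : Fm → List Fm
  fl⁻ (atom x)  = []
  fl⁻ ⊥̇         = []
  fl⁻ (¬̇ a)     = fl a
  fl⁻ (a ∨̇ b)   = fl a ++ fl b
  fl⁻ (⟨ π ⟩ a) = fl◇⁻ π a (fl a)
  fl⁻ (□ a)     = fl a

  fl◇ : Prog → Fm → List Fm → List Fm
  fl◇ π a tl = ⟨ π ⟩ a ∷ fl◇⁻ π a tl

  fl◇⁻ : Prog → Fm → List Fm → List Fm
  fl◇⁻ (patom p) a tl = tl
  fl◇⁻ (π₁ ⨾ π₂) a tl = fl◇ π₁ (⟨ π₂ ⟩ a) (fl◇ π₂ a tl)
  fl◇⁻ (π₁ ∪̇ π₂) a tl = fl◇ π₁ a (fl◇ π₂ a tl)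
  fl◇⁻ (π *)     a tl = fl◇ π (⟨ π * ⟩ a) (fl◇ π a tl)
  fl◇⁻ (¿ b)     a tl = fl b ++ tl

fl◇-suffix : ∀ π a tl → tl ⊆ fl◇ π a tl
fl◇-suffix (patom p) a tl = there
fl◇-suffix (π₁ ⨾ π₂) a tl = there ∘ fl◇-suffix π₁ (⟨ π₂ ⟩ a) _ ∘ fl◇-suffix π₂ a tl
fl◇-suffix (π₁ ∪̇ π₂) a tl = there ∘ fl◇-suffix π₁ a _ ∘ fl◇-suffix π₂ a tl
fl◇-suffix (π *)     a tl = there ∘ fl◇-suffix π (⟨ π * ⟩ a) _ ∘ fl◇-suffix π a tl
fl◇-suffix (¿ b)     a tl = there ∘ xs⊆ys++xs tl (fl b)

-- Because of the loop ⟨π⟩⟨π*⟩a ⟶ ⟨π*⟩a, fl◇ π a tl is only closed relative to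
-- an ambient list L containing it.
mutual
  fl-closed : ∀ a → Closed (fl a)
  fl-closed (¬̇ a)     (here refl) s-neg = there (here refl)
  fl-closed (a ∨̇ b)   (here refl) s-orL = there (here refl)
  fl-closed (a ∨̇ b)   (here refl) s-orR = there (∈-++⁺ʳ (fl a) (here refl))
  fl-closed (□ a)     (here refl) s-box = there (here refl)
  fl-closed (¬̇ a)     (there m)   s     = there (fl-closed a m s)
  fl-closed (a ∨̇ b)   (there m)   s with ∈-++⁻ (fl a) m
  ... | inj₁ m′ = there (∈-++⁺ˡ (fl-closed a m′ s))
  ... | inj₂ m′ = there (∈-++⁺ʳ (fl a) (fl-closed b m′ s))
  fl-closed (□ a)     (there m)   s     = there (fl-closed a m s)
  fl-closed (⟨ π ⟩ a) m           s     =
    fl◇-steps π a (fl◇-suffix π a _ (here refl)) ⊆-refl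
      (λ m′ s′ → fl◇-suffix π a _ (fl-closed a m′ s′)) m s

  fl◇-steps : ∀ π a {tl L} → a ∈ L → fl◇ π a tl ⊆ L → StepsInto tl L →
              StepsInto (fl◇ π a tl) L
  fl◇-steps π a a∈L ⊆L tl↝ (here refl) s-dia = a∈L
  fl◇-steps (¿ b) a a∈L ⊆L tl↝ (here refl) s-test = ⊆L (there (here refl))
  fl◇-steps (π₁ ⨾ π₂) a a∈L ⊆L tl↝ (here refl) s-seq = ⊆L (there (here refl))
  fl◇-steps (π₁ ∪̇ π₂) a a∈L ⊆L tl↝ (here refl) s-chL = ⊆L (there (here refl))
  fl◇-steps (π₁ ∪̇ π₂) a a∈L ⊆L tl↝ (here refl) s-chR =
    ⊆L (there (fl◇-suffix π₁ a _ (here refl)))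
  fl◇-steps (π *) a a∈L ⊆L tl↝ (here refl) s-st₁ = ⊆L (there (fl◇-suffix π _ _ (here refl)))
  fl◇-steps (π *) a a∈L ⊆L tl↝ (here refl) s-st₂ = ⊆L (there (here refl))
  fl◇-steps (patom p) a a∈L ⊆L tl↝ (there m) s = tl↝ m s
  fl◇-steps (π₁ ⨾ π₂) a a∈L ⊆L tl↝ (there m) s =
    fl◇-steps π₁ (⟨ π₂ ⟩ a) (⊆L (there (fl◇-suffix π₁ _ _ (here refl)))) (⊆L ∘ there)
      (fl◇-steps π₂ a a∈L (⊆L ∘ there ∘ fl◇-suffix π₁ _ _) tl↝) m s
  fl◇-steps (π₁ ∪̇ π₂) a a∈L ⊆L tl↝ (there m) s =
    fl◇-steps π₁ a a∈L (⊆L ∘ there)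
      (fl◇-steps π₂ a a∈L (⊆L ∘ there ∘ fl◇-suffix π₁ _ _) tl↝) m s
  fl◇-steps (π *) a a∈L ⊆L tl↝ (there m) s =
    fl◇-steps π (⟨ π * ⟩ a) (⊆L (here refl)) (⊆L ∘ there)
      (fl◇-steps π a a∈L (⊆L ∘ there ∘ fl◇-suffix π _ _) tl↝) m s
  fl◇-steps (¿ b) a a∈L ⊆L tl↝ (there m) s with ∈-++⁻ (fl b) m
  ... | inj₁ m′ = ⊆L (there (∈-++⁺ˡ (fl-closed b m′ s)))
  ... | inj₂ m′ = tl↝ m′ s

flList : List Fm → List Fm
flList []      = []
flList (a ∷ Γ) = fl a ++ flList Γ

flList-closed : ∀ Γ → Closed (flList Γ)
flList-closed (a ∷ Γ) m s with ∈-++⁻ (fl a) m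
... | inj₁ m′ = ∈-++⁺ˡ (fl-closed a m′ s)
... | inj₂ m′ = ∈-++⁺ʳ (fl a) (flList-closed Γ m′ s)

∈⇒∈flList : a ∈ Γ → a ∈ flList Γ
∈⇒∈flList (here refl)          = here refl
∈⇒∈flList {Γ = b ∷ _} (there m) = ∈-++⁺ʳ (fl b) (∈⇒∈flList m)

FL⇒∈flList : FL Γ a → a ∈ flList Γ
FL⇒∈flList     (base m)     = ∈⇒∈flList m
FL⇒∈flList {Γ} (sub-neg f)  = flList-closed Γ (FL⇒∈flList f) s-neg
FL⇒∈flList {Γ} (sub-orL f)  = flList-closed Γ (FL⇒∈flList f) s-orL
FL⇒∈flList {Γ} (sub-orR f)  = flList-closed Γ (FL⇒∈flList f) s-orR
FL⇒∈flList {Γ} (sub-dia f)  = flList-closed Γ (FL⇒∈flList f) s-dia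
FL⇒∈flList {Γ} (sub-box f)  = flList-closed Γ (FL⇒∈flList f) s-box
FL⇒∈flList {Γ} (fl-test f)  = flList-closed Γ (FL⇒∈flList f) s-test
FL⇒∈flList {Γ} (fl-seq f)   = flList-closed Γ (FL⇒∈flList f) s-seq
FL⇒∈flList {Γ} (fl-chL f)   = flList-closed Γ (FL⇒∈flList f) s-chL
FL⇒∈flList {Γ} (fl-chR f)   = flList-closed Γ (FL⇒∈flList f) s-chR
FL⇒∈flList {Γ} (fl-star₁ f) = flList-closed Γ (FL⇒∈flList f) s-st₁
FL⇒∈flList {Γ} (fl-star₂ f) = flList-closed Γ (FL⇒∈flList f) s-st₂

complementary⇒inconsistent : a ∈ Δ → ¬̇ a ∈ Δ → ¬ Consistent (⋀ Δ)
complementary⇒inconsistent a∈Δ ¬a∈Δ con = con (refute (⋀-elim a∈Δ) (⋀-elim ¬a∈Δ))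

complete⇒maximal : (∀ {a} → FL Γ a → a ∈ Δ ⊎ ¬̇ a ∈ Δ) →
                   ∀ a → FL± Γ a → Consistent (⋀ (a ∷ Δ)) → a ∈ Δ
complete⇒maximal complete a (inj₁ fl-a) con with complete fl-a
... | inj₁ a∈Δ  = a∈Δ
... | inj₂ ¬a∈Δ = contradiction (uncurry¬ʳ (⋀-elim ¬a∈Δ)) con
complete⇒maximal complete _ (inj₂ (a , fl-a , refl)) con with complete fl-a
... | inj₁ a∈Δ  = contradiction (uncurry¬¬ʳ (⋀-elim a∈Δ)) con
... | inj₂ ¬a∈Δ = ¬a∈Δ

Rc□-consistentʳ : ∀ W A → Rc□ W A → Consistent (⋀ A)
Rc□-consistentʳ W A r ⊢¬A = r (□¬⇒¬◇ (⇒-weaken (nec-box ⊢¬A)))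

Rc□-split : ∀ W A → Rc□ W A → DoubleNegation (Rc□ W (a ∷ A) ⊎ Rc□ W (¬̇ a ∷ A))
Rc□-split W A r k = k (inj₁ λ p → k (inj₂ λ q → r (◇-split p q)))

¬□⇒Rc□¬ : ∀ W → Consistent (⋀ W) → ⊢ ⋀ W ⇒ ¬̇ □ γ → Rc□ W (¬̇ γ ∷ [])
¬□⇒Rc□¬ {γ} W con W⇒¬□γ incon =
  con (refute (⇒-trans (¬◇⇒□¬ incon) (□-mono ¬[¬γ∧⊤]⇒γ)) W⇒¬□γ)
  where
  ¬[¬γ∧⊤]⇒γ : ⊢ ¬̇ (¬̇ γ ∧̇ ⊤̇) ⇒ γ
  ¬[¬γ∧⊤]⇒γ = tautology (¬ˢ (¬ˢ P ∧ˢ ⊤ˢ) ⇒ˢ P) (γ ∷ [])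

module Lindenbaum (Γ W : List Fm) where

  record Extension (A L : List Fm) : Set where
    field
      carrier  : List Fm
      related  : Rc□ W carrier
      ⊆FL±     : ∀ {a} → a ∈ carrier → FL± Γ a
      extends  : A ⊆ carrier
      complete : ∀ {a} → a ∈ L → FL Γ a → a ∈ carrier ⊎ ¬̇ a ∈ carrier

  open Extension

  skip : ∀ {L} → ¬ FL Γ a → Extension A L → Extension A (a ∷ L)
  skip ¬fl E = record
    { carrier = carrier E ; related = related E ; ⊆FL± = ⊆FL± E ; extends = extends E
    ; complete = λ { (here refl) fl → contradiction fl ¬fl ; (there m) → complete E m } }

  settle : ∀ {L} → (∀ {Δ} → b ∈ Δ → a ∈ Δ ⊎ ¬̇ a ∈ Δ) →
           Extension (b ∷ A) L → Extension A (a ∷ L)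
  settle decided E = record
    { carrier = carrier E ; related = related E ; ⊆FL± = ⊆FL± E ; extends = extends E ∘ there
    ; complete = λ { (here refl) _ → decided (extends E (here refl)) ; (there m) → complete E m } }

  extend : ∀ L {A} → Rc□ W A → (∀ {a} → a ∈ A → FL± Γ a) → DoubleNegation (Extension A L)
  extend [] {A} r ⊆FL = pure (record
    { carrier = A ; related = r ; ⊆FL± = ⊆FL ; extends = λ m → m ; complete = λ () })
  extend (a ∷ L) {A} r ⊆FL = ¬¬-excluded-middle >>= λ where
    (no ¬fl) → skip ¬fl <$> extend L r ⊆FL
    (yes fl) → Rc□-split W A r >>= λ where
      (inj₁ r⁺) → settle inj₁ <$>
        extend L r⁺ λ { (here refl) → inj₁ fl ; (there m) → ⊆FL m }
      (inj₂ r⁻) → settle inj₂ <$>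
        extend L r⁻ λ { (here refl) → inj₂ (a , fl , refl) ; (there m) → ⊆FL m }

  extension-MCS : (E : Extension A (flList Γ)) → MCS Γ (carrier E)
  extension-MCS E = ⊆FL± E , Rc□-consistentʳ W (carrier E) (related E) ,
                    complete⇒maximal (λ fl → complete E (FL⇒∈flList fl) fl)

FL±-□ : FL± Γ (□ γ) → FL Γ γ
FL±-□ (inj₁ fl) = sub-box fl

□∈⇒∈successor : ∀ {W W′} → □ γ ∈ W → FL Γ γ → MCS Γ W′ → Rc□ W W′ → γ ∈ W′
□∈⇒∈successor □γ∈W fl (_ , _ , maximal) r = maximal _ (inj₁ fl) λ incon →
  r (□¬⇒¬◇ (⇒-trans (⋀-elim □γ∈W) (□-mono (curry¬ incon))))

∈successors⇒□∈ : ∀ {W} → MCS Γ W → FL± Γ (□ γ) →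
                 (∀ W′ → MCS Γ W′ → Rc□ W W′ → γ ∈ W′) → □ γ ∈ W
∈successors⇒□∈ {Γ} {γ} {W} (_ , con , maximal) fl hyp = maximal _ fl λ incon →
  extend (flList Γ) {¬̇ γ ∷ []} (¬□⇒Rc□¬ W con (curry¬ʳ incon))
    (λ { (here refl) → inj₂ (γ , FL±-□ fl , refl) ; (there ()) })
    λ E → let open Extension E in
      complementary⇒inconsistent (hyp carrier (extension-MCS E) related) (extends (here refl))
        (Rc□-consistentʳ W carrier related)
  where open Lindenbaum Γ W

lemma7 : (Γ W : List Fm) → MCS Γ W → (γ : Fm) →
         FL± Γ (□ γ) → Consistent (□ γ) →
         ((□ γ) ∈ W ⇔ (∀ (W' : List Fm) → MCS Γ W' → Rc□ W W' → γ ∈ W'))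
lemma7 Γ W mcs γ fl _ = mk⇔
  (λ □γ∈W _ → □∈⇒∈successor □γ∈W (FL±-□ fl))
  (∈successors⇒□∈ mcs fl)
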